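{- Let $k_1,k_2,k_3\in\mathbb{Z}_{\ge0}$ and let $p,q$ be coprime positive integers. In the poset $\mathcal{P}_{p/q}$, the number of elements labeled $x_1$ is $d_1(q+p-1)$, the number labeled $x_2$ is $d_2(q-1)$, and the number labeled $x_3$ is $d_3(p-1)$. In particular $|\mathcal{P}_{p/q}|=d_1(q+p-1)+d_2(q-1)+d_3(p-1)$ and $|\widetilde{\mathcal{P}}_{p/q}|=d_1(q+p)+d_2q+d_3p$.
   Context: Set $d_i=1$ if $k_i=0$ and $d_i=2$ if $k_i>0$, and $\widehat{x_1}=x_2/x_3$, $\widehat{x_2}=x_3/x_1$, $\widehat{x_3}=x_1/x_2$. A fence poset with chronological ordering is a finite poset with an enumeration $\mathcal{P}(1),\dots,\mathcal{P}(h)$ of its elements such that for each $i<h$ exactly one of $\mathcal{P}(i)<\mathcal{P}(i+1)$, $\mathcal{P}(i)>\mathcal{P}(i+1)$ is declared, the order being the transitive closure of these; $L_{\mathcal{P}}=\mathcal{P}(1)$, $R_{\mathcal{P}}=\mathcal{P}(h)$. Each element carries a label in $\{x_1,x_2,x_3\}$ and a weight. For two such posets, $\mathcal{P}\nearrow\mathcal{P}'$ is the fence poset on the disjoint union with concatenated enumeration and the extra relation $R_{\mathcal{P}}<L_{\mathcal{P}'}$. Construction of $\mathcal{P}_{p/q}$: let $\Lambda$ be the set of lattice segments joining $(m,n)$ to $(m+1,n)$ (label $x_3$), $(m,n)$ to $(m,n+1)$ (label $x_2$), or $(m,n+1)$ to $(m+1,n)$ (label $x_1$), $m,n\in\mathbb{Z}$.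 Let $\gamma$ be the segment from $(0,0)$ to $(q,p)$, traversed from $(0,0)$; let $\tau_1,\dots,\tau_m$ be the segments of $\Lambda$ crossed by $\gamma$ away from its endpoints, in order of crossing; "left/right" is with respect to the direction of travel of $\gamma$. For each $\tau_j$ with label $x_a$ introduce, consecutively in the enumeration, one element of weight $\widehat{x_a}^2$ if $k_a=0$, or two elements if $k_a>0$: the first is greater than the second if $\gamma$ crosses $\tau_j$ strictly closer to its right endpoint than to its left endpoint and smaller otherwise, the smaller one having weight $k_a\widehat{x_a}$ and the larger weight $\widehat{x_a}/k_a$; all these elements are labeled $x_a$. Between the last element of the group of $\tau_j$ and the first element of the group of $\tau_{j+1}$ (these segments share an endpoint), declare the former greater if the shared endpoint lies to the right of $\gamma$ and smaller otherwise. $H$ is the chain (total order) consisting, from top to bottom, of the $x_3$-elements, then the $x_1$-elements, then the $x_2$-elements, where for each $i$: if $k_i>0$ there are two $x_i$-elements, the upper of weight $\widehat{x_i}/k_i$ and the lower of weight $k_i\widehat{x_i}$, and if $k_i=0$ there is one $x_i$-element of weight $\widehat{x_i}^2$; its enumeration runs from top to bottom. $\widetilde{\mathcal{P}}_{p/q}:=\mathcal{P}_{p/q}\nearrow H$. -}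

module Defs where

open import Data.Nat using (ℕ; zero; suc; _+_; _*_; _∸_; _<ᵇ_; _≤ᵇ_; _≡ᵇ_)
open import Data.Integer as ℤ using (ℤ; +_; +[1+_]; -[1+_]; _-_)
open import Data.Bool using (Bool; true; false; if_then_else_; _∧_)
open import Data.List using (List; []; _∷_; _++_; length; filter; concatMap; upTo; map; foldr)
open import Data.Maybe using (Maybe; just; nothing)
open import Data.Product using (_×_; _,_; proj₁; proj₂)

data Label : Set where
  x₁ x₂ x₃ : Label

record Ks : Set where
  constructor ks
  field
    k₁ k₂ k₃ : ℕ

kOf : Ks → Label → ℕ
kOf (ks a b c) x₁ = a
kOf (ks a b c) x₂ = b
kOf (ks a b c) x₃ = c

d : Ks → Label → ℕ
d K a with kOf K a
... | zero  = 1
... | suc _ = 2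

_≟L_ : Label → Label → Bool
x₁ ≟L x₁ = true
x₂ ≟L x₂ = true
x₃ ≟L x₃ = true
_  ≟L _  = false

-- Formal weights: hat-x_a ^ 2,  k_a * hat-x_a,  hat-x_a / k_a  (symbolic)

data Weight : Set where
  hatSq    : Label → Weight
  kHat     : Label → Weight
  hatOverK : Label → Weight

record Elem : Set where
  constructor elem
  field
    label  : Label
    weight : Weight

-- relation between P(i) and P(i+1):  up means P(i) < P(i+1), down means P(i) > P(i+1)
data Rel : Set where
  up down : Rel

-- A fence poset with chronological ordering, given by its enumeration
-- P(1),...,P(h) (list of labelled, weighted elements) and the declared
-- relations between consecutive elements (list of length h - 1).
-- The order is the transitive closure of the declared relations.
record Fence : Set where
  constructor fence
  field
    elems : List Elem
    rels  : List Rel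
open Fence public

joinWith : Rel → Fence → Fence → Fence
joinWith r (fence e rs) (fence e' rs') = fence (e ++ e') (rs ++ (r ∷ rs'))

_↗_ : Fence → Fence → Fence
P ↗ P' = joinWith up P P'

size : Fence → ℕ
size P = length (elems P)

countList : Label → List Elem → ℕ
countList a [] = 0
countList a (e ∷ es) = (if Elem.label e ≟L a then 1 else 0) + countList a es

countLabel : Label → Fence → ℕ
countLabel a P = countList a (elems P)

-- The chain H: from top to bottom x₃-elements, x₁-elements, x₂-elements.
-- Enumeration from top to bottom, so every declared relation is "down".

chainBlock : Ks → Label → List Elem
chainBlock K a with kOf K a
... | zero  = elem a (hatSq a) ∷ []
... | suc _ = elem a (hatOverK a) ∷ elem a (kHat a) ∷ []

downs : List Elem → List Rel
downs []       = []
downs (_ ∷ []) = []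
downs (_ ∷ e ∷ es) = down ∷ downs (e ∷ es)

H : Ks → Fence
H K = fence es (downs es)
  where es = chainBlock K x₃ ++ chainBlock K x₁ ++ chainBlock K x₂

-- Lattice points; γ is the segment from (0,0) to (q,p).
-- For a point P = (x,y) put f(P) = p·x − q·y.  Relative to the direction
-- of travel (q,p) of γ, P lies strictly to the left of (the line of) γ iff
-- f(P) < 0 and strictly to the right iff f(P) > 0.

Point : Set
Point = ℕ × ℕ

fval : ℕ → ℕ → Point → ℤ
fval p q (x , y) = (+ (p * x)) - (+ (q * y))

_≟P_ : Point → Point → Bool
(a , b) ≟P (c , e) = (a ≡ᵇ c) ∧ (b ≡ᵇ e)

record Segment : Set where
  constructor seg
  field
    slabel : Label
    endA endB : Point

-- candidate segments of Λ with (m,n) ∈ [0,q] × [0,p]; every segment of Λ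
-- crossed by γ away from its endpoints is among them
candidates : ℕ → ℕ → List Segment
candidates p q =
  concatMap (λ m → concatMap (λ n →
      seg x₃ (m , n) (suc m , n)
    ∷ seg x₂ (m , n) (m , suc n)
    ∷ seg x₁ (m , suc n) (suc m , n)
    ∷ []) (upTo (suc p))) (upTo (suc q))

-- data of a crossing: the segment, its left endpoint L and right endpoint R
-- (w.r.t. γ), the distances |f(L)| = suc nL, |f(R)| = suc nR to the line
-- (up to the common factor), and the x-coordinate of the crossing point
-- as a fraction num / den with den > 0.
record Crossing : Set where
  constructor crossing
  field
    cseg : Segment
    Lpt Rpt : Point
    nL nR : ℕ
  -- crossing point X = L + s (R − L), s = |f L| / (|f L| + |f R|)
  num : ℕ
  num = proj₁ Lpt * suc nR + proj₁ Rpt * suc nL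
  den : ℕ
  den = suc nL + suc nR
  closerRight : Bool
  closerRight = nR <ᵇ nL
open Crossing public

-- the segment is crossed transversally by the line of γ (endpoints strictly
-- on opposite sides); the endpoint with f < 0 is the left one
mkCrossing : ℕ → ℕ → Segment → Maybe Crossing
mkCrossing p q s@(seg a A B) with fval p q A | fval p q B
... | -[1+ u ] | +[1+ v ] = just (crossing s A B u v)
... | +[1+ u ] | -[1+ v ] = just (crossing s B A v u)
... | _        | _        = nothing

-- the crossing point lies on γ away from its endpoints:
-- 0 < x-coordinate < q  (γ has x-coordinate running over [0,q], q > 0)
interior : ℕ → Crossing → Bool
interior q c = (0 <ᵇ num c) ∧ (num c <ᵇ q * den c)

crossings : ℕ → ℕ → List Segment → List Crossing
crossings p q [] = []
crossings p q (s ∷ ss) with mkCrossing p q s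
... | nothing = crossings p q ss
... | just c  = if interior q c then c ∷ crossings p q ss else crossings p q ss

-- order of crossing along γ = order of the x-coordinate of the crossing point
_≤X_ : Crossing → Crossing → Bool
c ≤X c' = (num c * den c') ≤ᵇ (num c' * den c)

insertX : Crossing → List Crossing → List Crossing
insertX c [] = c ∷ []
insertX c (c' ∷ cs) = if c ≤X c' then c ∷ c' ∷ cs else c' ∷ insertX c cs

sortX : List Crossing → List Crossing
sortX = foldr insertX []

taus : ℕ → ℕ → List Crossing
taus p q = sortX (crossings p q (candidates p q))

group : Ks → Crossing → Fence
group K c with kOf K (Segment.slabel (cseg c)) | closerRight c
... | zero  | _     = fence (elem a (hatSq a) ∷ []) []
  where a = Segment.slabel (cseg c)
... | suc _ | true  = fence (elem a (hatOverK a) ∷ elem a (kHat a) ∷ []) (down ∷ [])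
  where a = Segment.slabel (cseg c)
... | suc _ | false = fence (elem a (kHat a) ∷ elem a (hatOverK a) ∷ []) (up ∷ [])
  where a = Segment.slabel (cseg c)

-- relation between the last element of the group of τⱼ and the first of the
-- group of τⱼ₊₁: "down" (former greater) iff the shared endpoint lies to the
-- right of γ, i.e. iff the right endpoints of τⱼ and τⱼ₊₁ coincide
linkRel : Crossing → Crossing → Rel
linkRel c c' = if Rpt c ≟P Rpt c' then down else up

emptyFence : Fence
emptyFence = fence [] []

assemble : Ks → List Crossing → Fence
assemble K [] = emptyFence
assemble K (c ∷ []) = group K c
assemble K (c ∷ c' ∷ cs) = joinWith (linkRel c c') (group K c) (assemble K (c' ∷ cs))

Pposet : Ks → ℕ → ℕ → Fence
Pposet K p q = assemble K (taus p q)

Ptilde : Ks → ℕ → ℕ → Fence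
Ptilde K p q = Pposet K p q ↗ H K

module Submission where

-- Each segment τ of Λ crossed by γ contributes a group of d_a elements labelled a, and
-- neither the sorting of the crossings nor the gluing of the groups changes how many there
-- are; so the number of a-elements is d_a times the number of a-segments crossed.  With
-- f(x, y) = p x - q y, a segment is crossed iff f changes sign strictly along it, and
-- coprimality of p and q keeps γ off every lattice point strictly between its ends.  Hence
-- each vertical x = m (0 < m < q) is crossed in exactly one x₂-segment and each horizontal
-- y = n (0 < n < p) in exactly one x₃-segment.  In the column m < q, the crossed
-- x₁-segments are the antidiagonals of the unit squares γ passes through: the one where it
-- enters the column, plus one for each horizontal line crossed there.  This gives q - 1,
-- p - 1 and q + (p - 1) crossings; the chain H adds one group of each label.

open import Defs
open import Data.Bool using (Bool; true; false; T; _∧_; if_then_else_)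
open import Data.Bool.Properties using (T-∧; ∧-zeroʳ; ∧-identityʳ)
open import Data.List using (List; []; _∷_; _++_; [_]; length; map; concatMap; upTo)
open import Data.List.Properties using (length-++; map-++; upTo-∷ʳ)
open import Data.Nat
open import Data.Nat.Coprimality as Coprimality using (Coprime; coprime-divisor)
open import Data.Nat.Divisibility using (divides; ∣⇒≤)
open import Data.Nat.ListAction using (sum)
open import Data.Nat.ListAction.Properties using (sum-++)
open import Data.Nat.Properties
open import Algebra.Properties.CommutativeSemigroup +-commutativeSemigroup using (interchange; x∙yz≈y∙xz)
open import Data.Product using (_×_; _,_; proj₂)
open import Data.Nat.Tactic.RingSolver using (solve; solve-∀)
open import Function using (_∘_)
open import Function.Bundles using (Equivalence; mk⇔)
open import Relation.Binary.PropositionalEquality hiding ([_])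
open import Relation.Nullary using (¬_; yes; no; contradiction)
open import Relation.Nullary.Decidable using (dec-true; dec-false; does-⇔)

𝟙 : Bool → ℕ
𝟙 true  = 1
𝟙 false = 0

∑< : ℕ → (ℕ → ℕ) → ℕ
∑< zero    f = 0
∑< (suc k) f = ∑< k f + f k

syntax ∑< k (λ i → e) = ∑[ i < k ] e

∑-cong : ∀ k {f g : ℕ → ℕ} → (∀ {i} → i < k → f i ≡ g i) → ∑< k f ≡ ∑< k g
∑-cong zero    f≡g = refl
∑-cong (suc k) f≡g = cong₂ _+_ (∑-cong k (f≡g ∘ m<n⇒m<1+n)) (f≡g (n<1+n k))

∑-const : ∀ k c → ∑[ i < k ] c ≡ k * c
∑-const zero    c = refl
∑-const (suc k) c = trans (cong (_+ c) (∑-const k c)) (+-comm (k * c) c)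

∑-distrib-+ : ∀ k (f g : ℕ → ℕ) → ∑[ i < k ] (f i + g i) ≡ ∑< k f + ∑< k g
∑-distrib-+ zero    f g = refl
∑-distrib-+ (suc k) f g =
  trans (cong (_+ (f k + g k)) (∑-distrib-+ k f g)) (interchange (∑< k f) (∑< k g) (f k) (g k))

∑-comm : ∀ a b (f : ℕ → ℕ → ℕ) → ∑[ i < a ] ∑[ j < b ] f i j ≡ ∑[ j < b ] ∑[ i < a ] f i j
∑-comm zero    b f = trans (sym (*-zeroʳ b)) (sym (∑-const b 0))
∑-comm (suc a) b f =
  trans (cong (_+ ∑< b (f a)) (∑-comm a b f)) (sym (∑-distrib-+ b (λ j → ∑[ i < a ] f i j) (f a)))

sum-map-upTo : ∀ (f : ℕ → ℕ) k → sum (map f (upTo k)) ≡ ∑< k f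
sum-map-upTo f zero    = refl
sum-map-upTo f (suc k) = begin
  sum (map f (upTo (suc k)))       ≡⟨ cong (sum ∘ map f) (sym (upTo-∷ʳ k)) ⟩
  sum (map f (upTo k ++ [ k ]))     ≡⟨ cong sum (map-++ f (upTo k) [ k ]) ⟩
  sum (map f (upTo k) ++ [ f k ])   ≡⟨ sum-++ (map f (upTo k)) [ f k ] ⟩
  sum (map f (upTo k)) + (f k + 0) ≡⟨ cong₂ _+_ (sum-map-upTo f k) (+-identityʳ (f k)) ⟩
  ∑< k f + f k                     ∎
  where open ≡-Reasoning

sum-map-concatMap : ∀ {A B : Set} (f : B → ℕ) (g : A → List B) xs →
  sum (map f (concatMap g xs)) ≡ sum (map (λ x → sum (map f (g x))) xs)
sum-map-concatMap f g []       = refl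
sum-map-concatMap f g (x ∷ xs) = begin
  sum (map f (g x ++ concatMap g xs))                 ≡⟨ cong sum (map-++ f (g x) _) ⟩
  sum (map f (g x) ++ map f (concatMap g xs))         ≡⟨ sum-++ (map f (g x)) _ ⟩
  sum (map f (g x)) + sum (map f (concatMap g xs))    ≡⟨ cong (sum (map f (g x)) +_) (sum-map-concatMap f g xs) ⟩
  sum (map f (g x)) + sum (map (λ y → sum (map f (g y))) xs) ∎
  where open ≡-Reasoning

1+[n∸1+m]+m≡n : ∀ {m n} → m < n → suc (n ∸ suc m) + m ≡ n
1+[n∸1+m]+m≡n {m} {n} m<n = trans (cong (_+ m) (sym (+-∸-assoc 1 m<n))) (m∸n+n≡m (<⇒≤ m<n))

<ᵇ-true : ∀ {m n} → m < n → (m <ᵇ n) ≡ true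
<ᵇ-true {m} {n} = dec-true (m <? n)

<ᵇ-false : ∀ {m n} → ¬ m < n → (m <ᵇ n) ≡ false
<ᵇ-false {m} {n} = dec-false (m <? n)

≤ᵇ-true : ∀ {m n} → m ≤ n → (m ≤ᵇ n) ≡ true
≤ᵇ-true {m} {n} = dec-true (m ≤? n)

≤ᵇ-false : ∀ {m n} → ¬ m ≤ n → (m ≤ᵇ n) ≡ false
≤ᵇ-false {m} {n} = dec-false (m ≤? n)

<ᵇ≡≤ᵇ : ∀ {m n} → m ≢ n → (m <ᵇ n) ≡ (m ≤ᵇ n)
<ᵇ≡≤ᵇ {m} {n} m≢n = does-⇔ (mk⇔ <⇒≤ (λ m≤n → ≤∧≢⇒< m≤n m≢n)) (m <? n) (m ≤? n)

*-<ᵇ-cancelʳ : ∀ k .{{_ : NonZero k}} m n → (m * k <ᵇ n * k) ≡ (m <ᵇ n)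
*-<ᵇ-cancelʳ k m n = does-⇔ (mk⇔ (*-cancelʳ-< k m n) (*-monoˡ-< k)) (m * k <? n * k) (m <? n)

¬T⇒≡false : ∀ {b} → ¬ T b → b ≡ false
¬T⇒≡false {false} _  = refl
¬T⇒≡false {true}  ¬t = contradiction _ ¬t

∧-redundantʳ : ∀ {b c} → (T b → T c) → b ∧ c ≡ b
∧-redundantʳ {false}         _   = refl
∧-redundantʳ {true} {true}   _   = refl
∧-redundantʳ {true} {false} b⇒c = contradiction (b⇒c _) λ ()

∑-𝟙-∧-guard : ∀ K (b : ℕ → Bool) c → (T c → ∑[ i < K ] 𝟙 (b i) ≡ 1) →
  ∑[ i < K ] 𝟙 (b i ∧ c) ≡ 𝟙 c
∑-𝟙-∧-guard K b false _     =
  trans (∑-cong K (λ {i} _ → cong 𝟙 (∧-zeroʳ (b i)))) (trans (∑-const K 0) (*-zeroʳ K))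
∑-𝟙-∧-guard K b true  sum≡1 =
  trans (∑-cong K (λ {i} _ → cong 𝟙 (∧-identityʳ (b i)))) (sum≡1 _)

𝟙-<-split : ∀ x y z → y ≤ z → 𝟙 (x <ᵇ y) + 𝟙 ((y ≤ᵇ x) ∧ (x <ᵇ z)) ≡ 𝟙 (x <ᵇ z)
𝟙-<-split x y z y≤z with x <? y
... | yes x<y rewrite <ᵇ-true x<y | ≤ᵇ-false (<⇒≱ x<y) | <ᵇ-true (<-≤-trans x<y y≤z) = refl
... | no  x≮y rewrite <ᵇ-false x≮y | ≤ᵇ-true (≮⇒≥ x≮y) = refl

∑-𝟙-floor : ∀ a x K → ∑[ i < K ] 𝟙 ((a * i ≤ᵇ x) ∧ (x <ᵇ a * suc i)) ≡ 𝟙 (x <ᵇ a * K)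
∑-𝟙-floor a x zero    rewrite *-zeroʳ a = refl
∑-𝟙-floor a x (suc K) =
  trans (cong (_+ 𝟙 ((a * K ≤ᵇ x) ∧ (x <ᵇ a * suc K))) (∑-𝟙-floor a x K))
        (𝟙-<-split x (a * K) (a * suc K) (*-monoʳ-≤ a (n≤1+n K)))

∑-𝟙-strictly-between : ∀ a x K → (∀ i → x ≢ a * i) →
  ∑[ i < K ] 𝟙 ((a * i <ᵇ x) ∧ (x <ᵇ a * suc i)) ≡ 𝟙 (x <ᵇ a * K)
∑-𝟙-strictly-between a x K x≢a* =
  trans (∑-cong K (λ {i} _ → cong (λ b → 𝟙 (b ∧ (x <ᵇ a * suc i))) (<ᵇ≡≤ᵇ (x≢a* i ∘ sym))))
        (∑-𝟙-floor a x K)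

∑-𝟙-positive : ∀ K → ∑[ i < K ] 𝟙 (0 <ᵇ i) ≡ K ∸ 1
∑-𝟙-positive zero          = refl
∑-𝟙-positive (suc zero)    = refl
∑-𝟙-positive (suc (suc K)) = trans (cong (_+ 1) (∑-𝟙-positive (suc K))) (+-comm K 1)

∑-𝟙-interior : ∀ K → ∑[ i < suc K ] 𝟙 ((0 <ᵇ i) ∧ (i <ᵇ K)) ≡ K ∸ 1
∑-𝟙-interior K rewrite <ᵇ-false (n≮n K) | ∧-zeroʳ (0 <ᵇ K) =
  trans (+-identityʳ _)
    (trans (∑-cong K (λ {i} i<K →
              trans (cong (λ b → 𝟙 ((0 <ᵇ i) ∧ b)) (<ᵇ-true i<K)) (cong 𝟙 (∧-identityʳ _))))
      (∑-𝟙-positive K))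

𝟙-overlap-split : ∀ a a' b b' → a < a' → b ≤ b' →
  𝟙 ((a <ᵇ b') ∧ (b <ᵇ a')) ≡ 𝟙 ((a <ᵇ b) ∧ (b <ᵇ a')) + 𝟙 ((b ≤ᵇ a) ∧ (a <ᵇ b'))
𝟙-overlap-split a a' b b' a<a' b≤b' with a <? b
... | yes a<b rewrite <ᵇ-true (<-≤-trans a<b b≤b') | <ᵇ-true a<b | ≤ᵇ-false (<⇒≱ a<b) =
  sym (+-identityʳ _)
... | no  a≮b rewrite <ᵇ-false a≮b | ≤ᵇ-true (≮⇒≥ a≮b) | <ᵇ-true (≤-<-trans (≮⇒≥ a≮b) a<a') =
  cong 𝟙 (∧-identityʳ _)

coprime⇒*≢* : ∀ {a b m} n → Coprime a b → 0 < m → m < b → a * m ≢ b * n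
coprime⇒*≢* {a} {b} {m} n a⊥b 0<m m<b am≡bn =
  <⇒≱ m<b (∣⇒≤ {{>-nonZero 0<m}} (coprime-divisor (Coprimality.sym a⊥b) (divides n (trans am≡bn (*-comm b n)))))

countCrossings : Label → List Crossing → ℕ
countCrossings a []       = 0
countCrossings a (c ∷ cs) = 𝟙 (Segment.slabel (cseg c) ≟L a) + countCrossings a cs

countCrossings-insertX : ∀ a c cs → countCrossings a (insertX c cs) ≡ countCrossings a (c ∷ cs)
countCrossings-insertX a c []        = refl
countCrossings-insertX a c (c' ∷ cs) with c ≤X c'
... | true  = refl
... | false = begin
  y + countCrossings a (insertX c cs) ≡⟨ cong (y +_) (countCrossings-insertX a c cs) ⟩
  y + (x + countCrossings a cs)       ≡⟨ x∙yz≈y∙xz y x _ ⟩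
  x + (y + countCrossings a cs)       ∎
  where
  open ≡-Reasoning
  x = 𝟙 (Segment.slabel (cseg c) ≟L a)
  y = 𝟙 (Segment.slabel (cseg c') ≟L a)

countCrossings-sortX : ∀ a cs → countCrossings a (sortX cs) ≡ countCrossings a cs
countCrossings-sortX a []       = refl
countCrossings-sortX a (c ∷ cs) =
  trans (countCrossings-insertX a c (sortX cs)) (cong (_ +_) (countCrossings-sortX a cs))

countList-++ : ∀ a xs ys → countList a (xs ++ ys) ≡ countList a xs + countList a ys
countList-++ a []       ys = refl
countList-++ a (x ∷ xs) ys =
  trans (cong (_ +_) (countList-++ a xs ys)) (sym (+-assoc (if Elem.label x ≟L a then 1 else 0) _ _))

𝟙-≟L-* : ∀ ℓ a (f : Label → ℕ) → 𝟙 (ℓ ≟L a) * f ℓ ≡ f a * 𝟙 (ℓ ≟L a)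
𝟙-≟L-* x₁ x₁ f = *-comm 1 (f x₁)
𝟙-≟L-* x₁ x₂ f = *-comm 0 (f x₂)
𝟙-≟L-* x₁ x₃ f = *-comm 0 (f x₃)
𝟙-≟L-* x₂ x₁ f = *-comm 0 (f x₁)
𝟙-≟L-* x₂ x₂ f = *-comm 1 (f x₂)
𝟙-≟L-* x₂ x₃ f = *-comm 0 (f x₃)
𝟙-≟L-* x₃ x₁ f = *-comm 0 (f x₁)
𝟙-≟L-* x₃ x₂ f = *-comm 0 (f x₂)
𝟙-≟L-* x₃ x₃ f = *-comm 1 (f x₃)

countList-group : ∀ K c a → countList a (elems (group K c)) ≡ d K a * 𝟙 (Segment.slabel (cseg c) ≟L a)
countList-group K c a = trans (group-of-label K c a) (𝟙-≟L-* (Segment.slabel (cseg c)) a (d K))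
  where
  group-of-label : ∀ K c a → let ℓ = Segment.slabel (cseg c) in
    countList a (elems (group K c)) ≡ 𝟙 (ℓ ≟L a) * d K ℓ
  group-of-label K c a with kOf K (Segment.slabel (cseg c)) | closerRight c
  group-of-label K c a | zero  | _     with Segment.slabel (cseg c) ≟L a
  ... | true  = refl
  ... | false = refl
  group-of-label K c a | suc _ | true  with Segment.slabel (cseg c) ≟L a
  ... | true  = refl
  ... | false = refl
  group-of-label K c a | suc _ | false with Segment.slabel (cseg c) ≟L a
  ... | true  = refl
  ... | false = refl

countList-assemble : ∀ K a cs → countList a (elems (assemble K cs)) ≡ d K a * countCrossings a cs
countList-assemble K a []            = sym (*-zeroʳ (d K a))
countList-assemble K a (c ∷ [])      = trans (countList-group K c a) (cong (d K a *_) (sym (+-identityʳ _)))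
countList-assemble K a (c ∷ c' ∷ cs) = begin
  countList a (elems (group K c) ++ elems (assemble K (c' ∷ cs)))
    ≡⟨ countList-++ a (elems (group K c)) _ ⟩
  countList a (elems (group K c)) + countList a (elems (assemble K (c' ∷ cs)))
    ≡⟨ cong₂ _+_ (countList-group K c a) (countList-assemble K a (c' ∷ cs)) ⟩
  d K a * 𝟙 (Segment.slabel (cseg c) ≟L a) + d K a * countCrossings a (c' ∷ cs)
    ≡⟨ *-distribˡ-+ (d K a) _ _ ⟨
  d K a * countCrossings a (c ∷ c' ∷ cs) ∎
  where open ≡-Reasoning

length≡countList-sum : ∀ es → length es ≡ countList x₁ es + countList x₂ es + countList x₃ es
length≡countList-sum [] = refl
length≡countList-sum (elem x₁ w ∷ es) = cong suc (length≡countList-sum es)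
length≡countList-sum (elem x₂ w ∷ es) =
  trans (cong suc (length≡countList-sum es)) (cong (_+ countList x₃ es) (sym (+-suc (countList x₁ es) _)))
length≡countList-sum (elem x₃ w ∷ es) =
  trans (cong suc (length≡countList-sum es)) (sym (+-suc (countList x₁ es + countList x₂ es) _))

length-chainBlock : ∀ K a → length (chainBlock K a) ≡ d K a
length-chainBlock K a with kOf K a
... | zero  = refl
... | suc _ = refl

size-H : ∀ K → size (H K) ≡ d K x₃ + (d K x₁ + d K x₂)
size-H K = begin
  length (chainBlock K x₃ ++ chainBlock K x₁ ++ chainBlock K x₂)
    ≡⟨ length-++ (chainBlock K x₃) ⟩
  length (chainBlock K x₃) + length (chainBlock K x₁ ++ chainBlock K x₂)
    ≡⟨ cong (length (chainBlock K x₃) +_) (length-++ (chainBlock K x₁)) ⟩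
  length (chainBlock K x₃) + (length (chainBlock K x₁) + length (chainBlock K x₂))
    ≡⟨ cong₂ _+_ (length-chainBlock K x₃) (cong₂ _+_ (length-chainBlock K x₁) (length-chainBlock K x₂)) ⟩
  d K x₃ + (d K x₁ + d K x₂) ∎
  where open ≡-Reasoning

module Geometry (p q : ℕ) where

  open import Data.Integer as ℤ using (+[1+_]; -[1+_]; 0ℤ)
  import Data.Integer.Properties as ℤ
  open import Data.Maybe using (just; nothing)

  fval-neg : ∀ {x y} → p * x < q * y → fval p q (x , y) ≡ -[1+ q * y ∸ suc (p * x) ]
  fval-neg {x} {y} lt =
    trans (ℤ.[+m]-[+n]≡m⊖n (p * x) (q * y)) (trans (ℤ.⊖-< lt) (cong (λ k → ℤ.- (ℤ.+ k)) (+-∸-assoc 1 lt)))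

  fval-pos : ∀ {x y} → q * y < p * x → fval p q (x , y) ≡ +[1+ p * x ∸ suc (q * y) ]
  fval-pos {x} {y} lt =
    trans (ℤ.[+m]-[+n]≡m⊖n (p * x) (q * y)) (trans (ℤ.⊖-≥ (<⇒≤ lt)) (cong ℤ.+_ (+-∸-assoc 1 lt)))

  fval-nonneg : ∀ {x y} → q * y ≤ p * x → 0ℤ ℤ.≤ fval p q (x , y)
  fval-nonneg le = ℤ.i≤j⇒0≤j-i (ℤ.+≤+ le)

  fval-nonpos : ∀ {x y} → p * x ≤ q * y → fval p q (x , y) ℤ.≤ 0ℤ
  fval-nonpos le = ℤ.i≤j⇒i-j≤0 (ℤ.+≤+ le)

  crossesInterior : Segment → Bool
  crossesInterior s with mkCrossing p q s
  ... | nothing = false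
  ... | just c  = interior q c

  mkCrossing-cseg : ∀ {ℓ A B c} → mkCrossing p q (seg ℓ A B) ≡ just c → cseg c ≡ seg ℓ A B
  mkCrossing-cseg {ℓ} {A} {B} with fval p q A | fval p q B
  ... | -[1+ _ ] | +[1+ _ ] = λ { refl → refl }
  ... | -[1+ _ ] | ℤ.+ zero   = λ ()
  ... | -[1+ _ ] | -[1+ _ ] = λ ()
  ... | +[1+ _ ] | -[1+ _ ] = λ { refl → refl }
  ... | +[1+ _ ] | ℤ.+ _      = λ ()
  ... | ℤ.+ zero   | _        = λ ()

  crossesInterior-nonneg : ∀ {ℓ A B} → 0ℤ ℤ.≤ fval p q A → 0ℤ ℤ.≤ fval p q B →
    crossesInterior (seg ℓ A B) ≡ false
  crossesInterior-nonneg {ℓ} {A} {B} 0≤A 0≤B with fval p q A | fval p q B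
  ... | ℤ.+ zero   | _        = refl
  ... | +[1+ _ ] | ℤ.+ _      = refl
  crossesInterior-nonneg _ () | +[1+ _ ] | -[1+ _ ]
  crossesInterior-nonneg () _ | -[1+ _ ] | _

  crossesInterior-nonpos : ∀ {ℓ A B} → fval p q A ℤ.≤ 0ℤ → fval p q B ℤ.≤ 0ℤ →
    crossesInterior (seg ℓ A B) ≡ false
  crossesInterior-nonpos {ℓ} {A} {B} A≤0 B≤0 with fval p q A | fval p q B
  ... | ℤ.+ zero   | _        = refl
  ... | -[1+ _ ] | ℤ.+ zero   = refl
  ... | -[1+ _ ] | -[1+ _ ] = refl
  crossesInterior-nonpos _ (ℤ.+≤+ ()) | -[1+ _ ] | +[1+ _ ]
  crossesInterior-nonpos (ℤ.+≤+ ()) _ | +[1+ _ ] | _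

  crossesInterior-left→right : ∀ {ℓ A B u v} → fval p q A ≡ -[1+ u ] → fval p q B ≡ +[1+ v ] →
    crossesInterior (seg ℓ A B) ≡ interior q (crossing (seg ℓ A B) A B u v)
  crossesInterior-left→right fA fB rewrite fA | fB = refl

  crossesInterior-right→left : ∀ {ℓ A B u v} → fval p q A ≡ +[1+ u ] → fval p q B ≡ -[1+ v ] →
    crossesInterior (seg ℓ A B) ≡ interior q (crossing (seg ℓ A B) B A v u)
  crossesInterior-right→left fA fB rewrite fA | fB = refl

  crossingWeight : Label → Segment → ℕ
  crossingWeight a s = 𝟙 ((Segment.slabel s ≟L a) ∧ crossesInterior s)

  countCrossings-crossings-∷ : ∀ a s ss →
    countCrossings a (crossings p q (s ∷ ss)) ≡ crossingWeight a s + countCrossings a (crossings p q ss)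
  countCrossings-crossings-∷ a (seg ℓ A B) ss with mkCrossing p q (seg ℓ A B) in eq
  ... | nothing = cong (_+ _) (cong 𝟙 (sym (∧-zeroʳ (ℓ ≟L a))))
  ... | just c with interior q c
  ...   | true  = cong (_+ _) (trans (cong (λ s → 𝟙 (Segment.slabel s ≟L a)) (mkCrossing-cseg eq))
                                     (cong 𝟙 (sym (∧-identityʳ (ℓ ≟L a)))))
  ...   | false = cong (_+ _) (cong 𝟙 (sym (∧-zeroʳ (ℓ ≟L a))))

  countCrossings-crossings : ∀ a ss → countCrossings a (crossings p q ss) ≡ sum (map (crossingWeight a) ss)
  countCrossings-crossings a []       = refl
  countCrossings-crossings a (s ∷ ss) =
    trans (countCrossings-crossings-∷ a s ss) (cong (crossingWeight a s +_) (countCrossings-crossings a ss))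

  -- A segment from L = (x, δ + y) to R = (x + 1, y) with |f L| = U and |f R| = V
  -- (δ = 0 for x₃, δ = 1 for x₁): the denominator and numerator of its crossing point.
  step-den : ∀ {x y δ U V} → U + p * x ≡ q * (δ + y) → V + q * y ≡ p * suc x → U + V ≡ p + q * δ
  step-den {x} {y} {δ} {U} {V} fL fR = +-cancelʳ-≡ (p * x + q * y) (U + V) (p + q * δ) (begin
    (U + V) + (p * x + q * y)     ≡⟨ interchange U V (p * x) (q * y) ⟩
    (U + p * x) + (V + q * y)     ≡⟨ cong₂ _+_ fL fR ⟩
    q * (δ + y) + p * suc x       ≡⟨ solve (x ∷ y ∷ δ ∷ p ∷ q ∷ []) ⟩
    (p + q * δ) + (p * x + q * y) ∎)
    where open ≡-Reasoning

  step-num : ∀ {x y δ U V} → U + p * x ≡ q * (δ + y) → V + q * y ≡ p * suc x →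
    x * V + suc x * U ≡ (x * δ + (δ + y)) * q
  step-num {x} {y} {δ} {U} {V} fL fR = +-cancelʳ-≡ (p * x) _ _ (begin
    x * V + suc x * U + p * x       ≡⟨ solve (x ∷ U ∷ V ∷ p ∷ []) ⟩
    x * (U + V) + (U + p * x)       ≡⟨ cong₂ (λ a b → x * a + b) (step-den fL fR) fL ⟩
    x * (p + q * δ) + q * (δ + y)   ≡⟨ solve (x ∷ y ∷ δ ∷ p ∷ q ∷ []) ⟩
    (x * δ + (δ + y)) * q + p * x   ∎)
    where open ≡-Reasoning

  interior-scaled : ∀ .{{_ : NonZero q}} c {N D} → num c ≡ N * q → den c ≡ D →
    interior q c ≡ (0 <ᵇ N) ∧ (N <ᵇ D)
  interior-scaled c {N} {D} num≡ den≡ rewrite num≡ | den≡ =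
    cong₂ _∧_ (*-<ᵇ-cancelʳ q 0 N) (trans (cong (N * q <ᵇ_) (*-comm q D)) (*-<ᵇ-cancelʳ q N D))

  interior-multiple : ∀ c {m} → num c ≡ m * den c → interior q c ≡ (0 <ᵇ m) ∧ (m <ᵇ q)
  interior-multiple c@(crossing _ _ _ _ _) {m} num≡ rewrite num≡ =
    cong₂ _∧_ (*-<ᵇ-cancelʳ (den c) 0 m) (*-<ᵇ-cancelʳ (den c) m q)

  -- The segments attached to the lattice point (m, n) in `candidates`: the horizontal
  -- one (x₃) and the vertical one (x₂) starting at (m, n), and the antidiagonal (x₁)
  -- of the unit square with lower left corner (m, n).  crossedCell a m n says that γ
  -- crosses the one labelled a away from its endpoints.
  crossedCell : Label → ℕ → ℕ → Bool
  crossedCell x₁ m n = ((p * m <ᵇ q * suc n) ∧ (q * n <ᵇ p * suc m)) ∧ (suc (m + n) <ᵇ p + q)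
  crossedCell x₂ m n = ((q * n <ᵇ p * m) ∧ (p * m <ᵇ q * suc n)) ∧ ((0 <ᵇ m) ∧ (m <ᵇ q))
  crossedCell x₃ m n = ((p * m <ᵇ q * n) ∧ (q * n <ᵇ p * suc m)) ∧ ((0 <ᵇ n) ∧ (n <ᵇ p))

  crossesInterior-horizontal : ∀ .{{_ : NonZero q}} ℓ m n →
    crossesInterior (seg ℓ (m , n) (suc m , n)) ≡ crossedCell x₃ m n
  crossesInterior-horizontal ℓ m n with p * m <? q * n | q * n <? p * suc m
  ... | no pm≮qn | _ rewrite <ᵇ-false pm≮qn =
    crossesInterior-nonneg (fval-nonneg (≮⇒≥ pm≮qn))
      (fval-nonneg (≤-trans (≮⇒≥ pm≮qn) (*-monoʳ-≤ p (n≤1+n m))))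
  ... | yes pm<qn | no qn≮psm rewrite <ᵇ-true pm<qn | <ᵇ-false qn≮psm =
    crossesInterior-nonpos (fval-nonpos (<⇒≤ pm<qn)) (fval-nonpos (≮⇒≥ qn≮psm))
  ... | yes pm<qn | yes qn<psm rewrite <ᵇ-true pm<qn | <ᵇ-true qn<psm =
    trans (crossesInterior-left→right (fval-neg pm<qn) (fval-pos qn<psm))
      (interior-scaled (crossing (seg ℓ (m , n) (suc m , n)) (m , n) (suc m , n) _ _)
                         (trans (step-num {δ = 0} fL fR) (cong (λ k → (k + n) * q) (*-zeroʳ m)))
                         (trans (step-den {δ = 0} fL fR) (trans (cong (p +_) (*-zeroʳ q)) (+-identityʳ p))))
    where
    fL : suc (q * n ∸ suc (p * m)) + p * m ≡ q * n
    fL = 1+[n∸1+m]+m≡n pm<qn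
    fR : suc (p * suc m ∸ suc (q * n)) + q * n ≡ p * suc m
    fR = 1+[n∸1+m]+m≡n qn<psm

  crossesInterior-vertical : ∀ ℓ m n →
    crossesInterior (seg ℓ (m , n) (m , suc n)) ≡ crossedCell x₂ m n
  crossesInterior-vertical ℓ m n with q * n <? p * m | p * m <? q * suc n
  ... | no qn≮pm | _ rewrite <ᵇ-false qn≮pm =
    crossesInterior-nonpos (fval-nonpos (≮⇒≥ qn≮pm))
      (fval-nonpos (≤-trans (≮⇒≥ qn≮pm) (*-monoʳ-≤ q (n≤1+n n))))
  ... | yes qn<pm | no pm≮qsn rewrite <ᵇ-true qn<pm | <ᵇ-false pm≮qsn =
    crossesInterior-nonneg (fval-nonneg (<⇒≤ qn<pm)) (fval-nonneg (≮⇒≥ pm≮qsn))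
  ... | yes qn<pm | yes pm<qsn rewrite <ᵇ-true qn<pm | <ᵇ-true pm<qsn =
    trans (crossesInterior-right→left (fval-pos qn<pm) (fval-neg pm<qsn))
      (interior-multiple (crossing (seg ℓ (m , n) (m , suc n)) (m , suc n) (m , n) _ _)
        (trans (sym (*-distribˡ-+ m _ _)) (cong (m *_) (+-comm (suc (p * m ∸ suc (q * n))) _))))

  crossesInterior-antidiagonal : ∀ .{{_ : NonZero q}} ℓ m n →
    crossesInterior (seg ℓ (m , suc n) (suc m , n)) ≡ crossedCell x₁ m n
  crossesInterior-antidiagonal ℓ m n with p * m <? q * suc n | q * n <? p * suc m
  ... | no pm≮qsn | _ rewrite <ᵇ-false pm≮qsn =
    crossesInterior-nonneg (fval-nonneg (≮⇒≥ pm≮qsn))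
      (fval-nonneg (≤-trans (*-monoʳ-≤ q (n≤1+n n)) (≤-trans (≮⇒≥ pm≮qsn) (*-monoʳ-≤ p (n≤1+n m)))))
  ... | yes pm<qsn | no qn≮psm rewrite <ᵇ-true pm<qsn | <ᵇ-false qn≮psm =
    crossesInterior-nonpos (fval-nonpos (<⇒≤ pm<qsn)) (fval-nonpos (≮⇒≥ qn≮psm))
  ... | yes pm<qsn | yes qn<psm rewrite <ᵇ-true pm<qsn | <ᵇ-true qn<psm =
    trans (crossesInterior-left→right (fval-neg pm<qsn) (fval-pos qn<psm))
      (interior-scaled (crossing (seg ℓ (m , suc n) (suc m , n)) (m , suc n) (suc m , n) _ _)
                         (trans (step-num {δ = 1} fL fR) (cong (_* q) (trans (cong (_+ suc n) (*-identityʳ m)) (+-suc m n))))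
                         (trans (step-den {δ = 1} fL fR) (cong (p +_) (*-identityʳ q))))
    where
    fL : suc (q * suc n ∸ suc (p * m)) + p * m ≡ q * suc n
    fL = 1+[n∸1+m]+m≡n pm<qsn
    fR : suc (p * suc m ∸ suc (q * n)) + q * n ≡ p * suc m
    fR = 1+[n∸1+m]+m≡n qn<psm

  cell : ℕ → ℕ → List Segment
  cell m n = seg x₃ (m , n) (suc m , n) ∷ seg x₂ (m , n) (m , suc n) ∷ seg x₁ (m , suc n) (suc m , n) ∷ []

  crossingWeight-cell : ∀ .{{_ : NonZero q}} a m n → sum (map (crossingWeight a) (cell m n)) ≡ 𝟙 (crossedCell a m n)
  crossingWeight-cell x₁ m n = trans (+-identityʳ _) (cong 𝟙 (crossesInterior-antidiagonal x₁ m n))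
  crossingWeight-cell x₂ m n = trans (+-identityʳ _) (cong 𝟙 (crossesInterior-vertical x₂ m n))
  crossingWeight-cell x₃ m n = trans (+-identityʳ _) (cong 𝟙 (crossesInterior-horizontal x₃ m n))

  countCrossings-candidates : ∀ .{{_ : NonZero q}} a →
    countCrossings a (crossings p q (candidates p q)) ≡ ∑[ m < suc q ] ∑[ n < suc p ] 𝟙 (crossedCell a m n)
  countCrossings-candidates a = begin
    countCrossings a (crossings p q (candidates p q))
      ≡⟨ countCrossings-crossings a (candidates p q) ⟩
    sum (map (crossingWeight a) (concatMap column (upTo (suc q))))
      ≡⟨ sum-map-concatMap (crossingWeight a) column (upTo (suc q)) ⟩
    sum (map (λ m → sum (map (crossingWeight a) (column m))) (upTo (suc q)))
      ≡⟨ sum-map-upTo _ (suc q) ⟩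
    ∑[ m < suc q ] sum (map (crossingWeight a) (column m))
      ≡⟨ ∑-cong (suc q) (λ {m} _ → columnWeight m) ⟩
    ∑[ m < suc q ] ∑[ n < suc p ] 𝟙 (crossedCell a m n) ∎
    where
    open ≡-Reasoning
    column : ℕ → List Segment
    column m = concatMap (cell m) (upTo (suc p))
    columnWeight : ∀ m → sum (map (crossingWeight a) (column m)) ≡ ∑[ n < suc p ] 𝟙 (crossedCell a m n)
    columnWeight m = trans (sum-map-concatMap (crossingWeight a) (cell m) (upTo (suc p)))
      (trans (sum-map-upTo _ (suc p)) (∑-cong (suc p) (λ {n} _ → crossingWeight-cell a m n)))

  countLabel-Pposet : ∀ .{{_ : NonZero q}} K a →
    countLabel a (Pposet K p q) ≡ d K a * ∑[ m < suc q ] ∑[ n < suc p ] 𝟙 (crossedCell a m n)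
  countLabel-Pposet K a =
    trans (countList-assemble K a (taus p q))
          (cong (d K a *_) (trans (countCrossings-sortX a (crossings p q (candidates p q))) (countCrossings-candidates a)))

module Counting (p q : ℕ) .{{_ : NonZero p}} .{{_ : NonZero q}} (p⊥q : Coprime p q) where

  open Geometry p q

  column : Label → ℕ → ℕ
  column a m = ∑[ n < suc p ] 𝟙 (crossedCell a m n)

  count : Label → ℕ
  count a = ∑[ m < suc q ] column a m

  n<p⇒qn<p[1+q] : ∀ {n} → n < p → q * n < p * suc q
  n<p⇒qn<p[1+q] {n} n<p = <-≤-trans (*-monoʳ-< q n<p) (≤-trans (≤-reflexive (*-comm q p)) (*-monoʳ-≤ p (n≤1+n q)))

  m<q⇒pm<q[1+p] : ∀ {m} → m < q → p * m < q * suc p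
  m<q⇒pm<q[1+p] {m} m<q = <-≤-trans (*-monoʳ-< p m<q) (≤-trans (≤-reflexive (*-comm p q)) (*-monoʳ-≤ q (n≤1+n p)))

  column-x₂ : ∀ m → column x₂ m ≡ 𝟙 ((0 <ᵇ m) ∧ (m <ᵇ q))
  column-x₂ m = ∑-𝟙-∧-guard (suc p) _ _ λ t →
    let 0<m , m<q = Equivalence.to T-∧ t in
    trans (∑-𝟙-strictly-between q (p * m) (suc p) (λ n → coprime⇒*≢* n p⊥q (<ᵇ⇒< 0 m 0<m) (<ᵇ⇒< m q m<q)))
          (cong 𝟙 (<ᵇ-true (m<q⇒pm<q[1+p] (<ᵇ⇒< m q m<q))))

  count-x₂ : count x₂ ≡ q ∸ 1
  count-x₂ = trans (∑-cong (suc q) (λ {m} _ → column-x₂ m)) (∑-𝟙-interior q)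

  count-x₃ : count x₃ ≡ p ∸ 1
  count-x₃ = begin
    ∑[ m < suc q ] ∑[ n < suc p ] 𝟙 (crossedCell x₃ m n)  ≡⟨ ∑-comm (suc q) (suc p) _ ⟩
    ∑[ n < suc p ] ∑[ m < suc q ] 𝟙 (crossedCell x₃ m n)  ≡⟨ ∑-cong (suc p) (λ {n} _ → row n) ⟩
    ∑[ n < suc p ] 𝟙 ((0 <ᵇ n) ∧ (n <ᵇ p))                ≡⟨ ∑-𝟙-interior p ⟩
    p ∸ 1                                                  ∎
    where
    open ≡-Reasoning
    row : ∀ n → ∑[ m < suc q ] 𝟙 (crossedCell x₃ m n) ≡ 𝟙 ((0 <ᵇ n) ∧ (n <ᵇ p))
    row n = ∑-𝟙-∧-guard (suc q) _ _ λ t →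
      let 0<n , n<p = Equivalence.to T-∧ t in
      trans (∑-𝟙-strictly-between p (q * n) (suc q)
               (λ m → coprime⇒*≢* m (Coprimality.sym p⊥q) (<ᵇ⇒< 0 n 0<n) (<ᵇ⇒< n p n<p)))
            (cong 𝟙 (<ᵇ-true (n<p⇒qn<p[1+q] (<ᵇ⇒< n p n<p))))

  column-last : ∀ a → (∀ n → ¬ T (crossedCell a q n)) → column a q ≡ 0
  column-last a never = trans (∑-cong (suc p) (λ {n} _ → cong 𝟙 (¬T⇒≡false (never n))))
                              (trans (∑-const (suc p) 0) (*-zeroʳ (suc p)))

  crossedCell-x₁-last : ∀ n → ¬ T (crossedCell x₁ q n)
  crossedCell-x₁-last n t =
    let crosses , interior-n = Equivalence.to T-∧ t
        pq<q[1+n] , _        = Equivalence.to T-∧ crosses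
        p≤n = s≤s⁻¹ (*-cancelˡ-< q p (suc n) (subst (_< q * suc n) (*-comm p q) (<ᵇ⇒< _ _ pq<q[1+n])))
    in <⇒≱ (<ᵇ⇒< _ _ interior-n) (≤-trans (≤-trans (+-monoˡ-≤ q p≤n) (≤-reflexive (+-comm n q))) (n≤1+n _))

  crossedCell-x₃-last : ∀ n → ¬ T (crossedCell x₃ q n)
  crossedCell-x₃-last n t =
    let crosses , interior-n = Equivalence.to T-∧ t
        pq<qn , _            = Equivalence.to T-∧ crosses
    in <⇒≯ (<ᵇ⇒< n p (proj₂ (Equivalence.to T-∧ interior-n)))
           (*-cancelˡ-< q p n (subst (_< q * n) (*-comm p q) (<ᵇ⇒< _ _ pq<qn)))

  -- γ meets the line x = m at height p m / q, in the unit square with lower left corner (m, n).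
  entersColumnAt : ℕ → ℕ → Bool
  entersColumnAt m n = (q * n ≤ᵇ p * m) ∧ (p * m <ᵇ q * suc n)

  crossedCell-x₁-split : ∀ {m} n → m < q →
    𝟙 (crossedCell x₁ m n) ≡ 𝟙 (crossedCell x₃ m n) + 𝟙 (entersColumnAt m n)
  crossedCell-x₁-split {m} n m<q = begin
    𝟙 (crossedCell x₁ m n)
      ≡⟨ cong 𝟙 (∧-redundantʳ x₁-interior) ⟩
    𝟙 ((p * m <ᵇ q * suc n) ∧ (q * n <ᵇ p * suc m))
      ≡⟨ 𝟙-overlap-split (p * m) (p * suc m) (q * n) (q * suc n) (*-monoʳ-< p (n<1+n m)) (*-monoʳ-≤ q (n≤1+n n)) ⟩
    𝟙 ((p * m <ᵇ q * n) ∧ (q * n <ᵇ p * suc m)) + 𝟙 (entersColumnAt m n)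
      ≡⟨ cong (_+ 𝟙 (entersColumnAt m n)) (cong 𝟙 (∧-redundantʳ x₃-interior)) ⟨
    𝟙 (crossedCell x₃ m n) + 𝟙 (entersColumnAt m n) ∎
    where
    open ≡-Reasoning
    n<p : q * n < p * suc m → n < p
    n<p qn<p[1+m] = *-cancelˡ-< q n p (<-≤-trans qn<p[1+m] (≤-trans (*-monoʳ-≤ p m<q) (≤-reflexive (*-comm p q))))
    x₁-interior : T ((p * m <ᵇ q * suc n) ∧ (q * n <ᵇ p * suc m)) → T (suc (m + n) <ᵇ p + q)
    x₁-interior t = <⇒<ᵇ (subst (suc (m + n) <_) (+-comm q p)
                            (+-mono-≤-< m<q (n<p (<ᵇ⇒< _ _ (proj₂ (Equivalence.to T-∧ t))))))
    x₃-interior : T ((p * m <ᵇ q * n) ∧ (q * n <ᵇ p * suc m)) → T ((0 <ᵇ n) ∧ (n <ᵇ p))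
    x₃-interior t =
      let pm<qn , qn<p[1+m] = Equivalence.to T-∧ t
          0<n = *-cancelˡ-< q 0 n (subst (_< q * n) (sym (*-zeroʳ q)) (≤-<-trans z≤n (<ᵇ⇒< _ _ pm<qn)))
      in Equivalence.from T-∧ (<⇒<ᵇ 0<n , <⇒<ᵇ (n<p (<ᵇ⇒< _ _ qn<p[1+m])))

  column-x₁ : ∀ {m} → m < q → column x₁ m ≡ column x₃ m + 1
  column-x₁ {m} m<q = begin
    column x₁ m
      ≡⟨ ∑-cong (suc p) (λ {n} _ → crossedCell-x₁-split n m<q) ⟩
    ∑[ n < suc p ] (𝟙 (crossedCell x₃ m n) + 𝟙 (entersColumnAt m n))
      ≡⟨ ∑-distrib-+ (suc p) _ _ ⟩
    column x₃ m + ∑[ n < suc p ] 𝟙 (entersColumnAt m n)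
      ≡⟨ cong (column x₃ m +_) (∑-𝟙-floor q (p * m) (suc p)) ⟩
    column x₃ m + 𝟙 (p * m <ᵇ q * suc p)
      ≡⟨ cong (λ b → column x₃ m + 𝟙 b) (<ᵇ-true (m<q⇒pm<q[1+p] m<q)) ⟩
    column x₃ m + 1 ∎
    where open ≡-Reasoning

  count-x₁ : count x₁ ≡ count x₃ + q
  count-x₁ = begin
    ∑< q (column x₁) + column x₁ q
      ≡⟨ cong₂ _+_ (∑-cong q column-x₁) (column-last x₁ crossedCell-x₁-last) ⟩
    ∑[ m < q ] (column x₃ m + 1) + 0
      ≡⟨ +-identityʳ _ ⟩
    ∑[ m < q ] (column x₃ m + 1)
      ≡⟨ ∑-distrib-+ q (column x₃) (λ _ → 1) ⟩
    ∑< q (column x₃) + ∑[ m < q ] 1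
      ≡⟨ cong₂ _+_ (sym (+-identityʳ _)) (trans (∑-const q 1) (*-identityʳ q)) ⟩
    ∑< q (column x₃) + 0 + q
      ≡⟨ cong (λ k → ∑< q (column x₃) + k + q) (column-last x₃ crossedCell-x₃-last) ⟨
    count x₃ + q ∎
    where open ≡-Reasoning

  countLabel-x₁ : ∀ K → countLabel x₁ (Pposet K p q) ≡ d K x₁ * (q + p ∸ 1)
  countLabel-x₁ K = trans (countLabel-Pposet K x₁) (cong (d K x₁ *_) (begin
    count x₁        ≡⟨ count-x₁ ⟩
    count x₃ + q    ≡⟨ cong (_+ q) count-x₃ ⟩
    (p ∸ 1) + q     ≡⟨ +-comm (p ∸ 1) q ⟩
    q + (p ∸ 1)     ≡⟨ +-∸-assoc q (>-nonZero⁻¹ p) ⟨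
    q + p ∸ 1       ∎))
    where open ≡-Reasoning

  countLabel-x₂ : ∀ K → countLabel x₂ (Pposet K p q) ≡ d K x₂ * (q ∸ 1)
  countLabel-x₂ K = trans (countLabel-Pposet K x₂) (cong (d K x₂ *_) count-x₂)

  countLabel-x₃ : ∀ K → countLabel x₃ (Pposet K p q) ≡ d K x₃ * (p ∸ 1)
  countLabel-x₃ K = trans (countLabel-Pposet K x₃) (cong (d K x₃ *_) count-x₃)

  size-Pposet : ∀ K → size (Pposet K p q) ≡ d K x₁ * (q + p ∸ 1) + d K x₂ * (q ∸ 1) + d K x₃ * (p ∸ 1)
  size-Pposet K = trans (length≡countList-sum (elems (Pposet K p q)))
                        (cong₂ _+_ (cong₂ _+_ (countLabel-x₁ K) (countLabel-x₂ K)) (countLabel-x₃ K))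

proposition7p6 : (k₁ k₂ k₃ p q : ℕ) → 1 ≤ p → 1 ≤ q → Coprime p q →
    let K = ks k₁ k₂ k₃ in
      (countLabel x₁ (Pposet K p q) ≡ d K x₁ * (q + p ∸ 1))
    × (countLabel x₂ (Pposet K p q) ≡ d K x₂ * (q ∸ 1))
    × (countLabel x₃ (Pposet K p q) ≡ d K x₃ * (p ∸ 1))
    × (size (Pposet K p q) ≡ d K x₁ * (q + p ∸ 1) + d K x₂ * (q ∸ 1) + d K x₃ * (p ∸ 1))
    × (size (Ptilde K p q) ≡ d K x₁ * (q + p) + d K x₂ * q + d K x₃ * p)
proposition7p6 k₁ k₂ k₃ p@(suc p′) q@(suc q′) (s≤s z≤n) (s≤s z≤n) p⊥q =
  countLabel-x₁ K , countLabel-x₂ K , countLabel-x₃ K , size-Pposet K , size-Ptilde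
  where
  open Counting p q p⊥q
  K : Ks
  K = ks k₁ k₂ k₃
  d₁ d₂ d₃ : ℕ
  d₁ = d K x₁
  d₂ = d K x₂
  d₃ = d K x₃
  size-Ptilde : size (Ptilde K p q) ≡ d₁ * (q + p) + d₂ * q + d₃ * p
  size-Ptilde = begin
    size (Ptilde K p q)                                          ≡⟨ length-++ (elems (Pposet K p q)) ⟩
    size (Pposet K p q) + size (H K)                             ≡⟨ cong₂ _+_ (size-Pposet K) (size-H K) ⟩
    d₁ * (q′ + p) + d₂ * q′ + d₃ * p′ + (d₃ + (d₁ + d₂))         ≡⟨ H-absorbs-∸1 d₁ d₂ d₃ ⟩
    d₁ * (q + p) + d₂ * q + d₃ * p                               ∎
    where
    open ≡-Reasoning
    H-absorbs-∸1 : ∀ a b c → a * (q′ + p) + b * q′ + c * p′ + (c + (a + b)) ≡ a * (q + p) + b * q + c * p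
    H-absorbs-∸1 a b c = solve (a ∷ b ∷ c ∷ p′ ∷ q′ ∷ [])
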